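{- $\chi_2(\mathcal B')\ge 3$. That is, for a fixed horizontal line $e$ there exists a finite point set $P$ in the plane such that for every coloring of $P$ with $2$ colors some axis-parallel rectangle intersecting $e$ contains at least $2$ points of $P$, all of the same color.
   Context: Fix a horizontal line $e$ in the plane; $\mathcal B'$ denotes the family of all axis-parallel rectangles intersecting $e$. For a family $\mathcal F$ of planar regions and an integer $k\ge 2$, $\chi_k(\mathcal F)$ is the smallest number $c$ such that every finite point set $P\subset\mathbb R^2$ admits a coloring with $c$ colors in which every $F\in\mathcal F$ with $|F\cap P|\ge k$ contains two points of $P$ of different colors.
   Formalization: The horizontal line e lies at a rational height, and the points of P and the corners of the rectangles are taken in ℚ² rather than ℝ². -}

module Defs where

open import Data.Rational using (ℚ; _≤_; _<_)
open import Data.Product using (_×_; _,_; proj₁; proj₂; ∃-syntax)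
open import Data.Fin using (Fin)
open import Data.List using (List)
open import Data.List.Membership.Propositional using (_∈_)
open import Data.List.Relation.Unary.Unique.Propositional using (Unique)
open import Relation.Binary.PropositionalEquality using (_≡_)
open import Relation.Nullary using (¬_)

Point : Set
Point = ℚ × ℚ

record Rect : Set where
  field
    x₁ x₂ y₁ y₂ : ℚ
    x₁<x₂ : x₁ < x₂
    y₁<y₂ : y₁ < y₂
open Rect public

_∈R_ : Point → Rect → Set
p ∈R R = (x₁ R ≤ proj₁ p × proj₁ p ≤ x₂ R) × (y₁ R ≤ proj₂ p × proj₂ p ≤ y₂ R)

MeetsLine : ℚ → Rect → Set
MeetsLine c R = y₁ R ≤ c × c ≤ y₂ R

Coloring : Set
Coloring = Point → Fin 2

MonoRect : List Point → Coloring → Rect → Set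
MonoRect P col R =
  (∃[ p ] ∃[ q ] (p ∈ P × q ∈ P × ¬ (p ≡ q) × p ∈R R × q ∈R R))
  × (∀ r s → r ∈ P → s ∈ P → r ∈R R → s ∈R R → col r ≡ col s)

ChiTwoAtLeastThree : ℚ → Set
ChiTwoAtLeastThree c =
  ∃[ P ] (Unique P × (∀ (col : Coloring) → ∃[ R ] (MeetsLine c R × MonoRect P col R)))

-- Put three points on and around the line y = c: A on it, B above it and C below it, with
-- B and C on a common vertical line to the right of A. Every pair of them is cut out of
-- the triple by a rectangle that meets the line, while among three points two colours
-- must repeat.
module Submission where

open import Defs
open import Data.Rational using (ℚ; 0ℚ; 1ℚ; _+_; _-_; -_; _<_; _≤_)
open import Data.Rational.Properties
  using (≤-refl; <⇒≤; <⇒≢; <-irrefl; <-≤-trans; <-trans; +-monoʳ-<; +-identityʳ; _<?_)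
open import Data.Product using (_×_; _,_; proj₁; proj₂; ∃-syntax)
open import Data.Sum using (_⊎_; inj₁; inj₂)
open import Data.Nat using (s≤s)
open import Data.Nat.Properties using (n<1+n)
open import Data.Fin using (Fin; zero; suc) renaming (_<_ to _<ᶠ_)
open import Data.Fin.Properties using (pigeonhole)
open import Data.Unit using (tt)
open import Data.Empty using (⊥-elim)
open import Data.List using (List; []; _∷_)
open import Data.List.Relation.Unary.Any using (here; there)
open import Data.List.Relation.Unary.AllPairs using ([]; _∷_)
open import Data.List.Relation.Unary.All using ([]; _∷_)
open import Data.List.Membership.Propositional using (_∈_)
open import Data.List.Relation.Unary.Unique.Propositional using (Unique)
open import Function using (_∘_)
open import Relation.Binary.PropositionalEquality using (_≡_; refl; sym; cong; subst)
open import Relation.Nullary using (¬_)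
open import Relation.Nullary.Decidable using (toWitness)

0<1 : 0ℚ < 1ℚ
0<1 = toWitness {a? = 0ℚ <? 1ℚ} tt

q<q+1 : ∀ q → q < q + 1ℚ
q<q+1 q = subst (_< q + 1ℚ) (+-identityʳ q) (+-monoʳ-< q 0<1)

-1<0 : - 1ℚ < 0ℚ
-1<0 = toWitness {a? = - 1ℚ <? 0ℚ} tt

q-1<q : ∀ q → q - 1ℚ < q
q-1<q q = subst (q - 1ℚ <_) (+-identityʳ q) (+-monoʳ-< q -1<0)

<⇒≱ : ∀ {p q : ℚ} → p < q → ¬ (q ≤ p)
<⇒≱ p<q q≤p = <-irrefl refl (<-≤-trans p<q q≤p)

CutsOut : List Point → Rect → Point → Point → Set
CutsOut P R p q = ∀ r → r ∈ P → r ∈R R → r ≡ p ⊎ r ≡ q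

monoRect-pair : ∀ {P col R p q} → p ∈ P → q ∈ P → ¬ p ≡ q → p ∈R R → q ∈R R →
                CutsOut P R p q → col p ≡ col q → MonoRect P col R
monoRect-pair {P} {col} {R} p∈P q∈P p≢q p∈R q∈R cut colp≡colq =
  (_ , _ , p∈P , q∈P , p≢q , p∈R , q∈R) , sameColour
  where
  sameColour : ∀ r s → r ∈ P → s ∈ P → r ∈R R → s ∈R R → col r ≡ col s
  sameColour r s r∈P s∈P r∈R s∈R with cut r r∈P r∈R | cut s s∈P s∈R
  ... | inj₁ refl | inj₁ refl = refl
  ... | inj₁ refl | inj₂ refl = colp≡colq
  ... | inj₂ refl | inj₁ refl = sym colp≡colq
  ... | inj₂ refl | inj₂ refl = refl

module Triangle (c : ℚ) where

  lo hi : ℚ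
  lo = c - 1ℚ
  hi = c + 1ℚ

  lo<hi : lo < hi
  lo<hi = <-trans (q-1<q c) (q<q+1 c)

  A B C : Point
  A = 0ℚ , c
  B = 1ℚ , hi
  C = 1ℚ , lo

  vertex : Fin 3 → Point
  vertex zero             = A
  vertex (suc zero)       = B
  vertex (suc (suc zero)) = C

  P : List Point
  P = A ∷ B ∷ C ∷ []

  A∈P : A ∈ P
  A∈P = here refl
  B∈P : B ∈ P
  B∈P = there (here refl)
  C∈P : C ∈ P
  C∈P = there (there (here refl))

  A≢B : ¬ A ≡ B
  A≢B = <⇒≢ 0<1 ∘ cong proj₁
  A≢C : ¬ A ≡ C
  A≢C = <⇒≢ 0<1 ∘ cong proj₁
  B≢C : ¬ B ≡ C
  B≢C = <⇒≢ lo<hi ∘ sym ∘ cong proj₂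

  P-unique : Unique P
  P-unique = (A≢B ∷ A≢C ∷ []) ∷ (B≢C ∷ []) ∷ [] ∷ []

  RAB RAC RBC : Rect
  RAB = record { x₁ = 0ℚ ; x₂ = 1ℚ ; y₁ = c ; y₂ = hi ; x₁<x₂ = 0<1 ; y₁<y₂ = q<q+1 c }
  RAC = record { x₁ = 0ℚ ; x₂ = 1ℚ ; y₁ = lo ; y₂ = c ; x₁<x₂ = 0<1 ; y₁<y₂ = q-1<q c }
  RBC = record { x₁ = 1ℚ ; x₂ = 1ℚ + 1ℚ ; y₁ = lo ; y₂ = hi ; x₁<x₂ = q<q+1 1ℚ ; y₁<y₂ = lo<hi }

  A∈RAB : A ∈R RAB
  A∈RAB = (≤-refl , <⇒≤ 0<1) , ≤-refl , <⇒≤ (q<q+1 c)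
  B∈RAB : B ∈R RAB
  B∈RAB = (<⇒≤ 0<1 , ≤-refl) , <⇒≤ (q<q+1 c) , ≤-refl
  A∈RAC : A ∈R RAC
  A∈RAC = (≤-refl , <⇒≤ 0<1) , <⇒≤ (q-1<q c) , ≤-refl
  C∈RAC : C ∈R RAC
  C∈RAC = (<⇒≤ 0<1 , ≤-refl) , ≤-refl , <⇒≤ (q-1<q c)
  B∈RBC : B ∈R RBC
  B∈RBC = (≤-refl , <⇒≤ (q<q+1 1ℚ)) , <⇒≤ lo<hi , ≤-refl
  C∈RBC : C ∈R RBC
  C∈RBC = (≤-refl , <⇒≤ (q<q+1 1ℚ)) , ≤-refl , <⇒≤ lo<hi

  cutsOut-AB : CutsOut P RAB A B
  cutsOut-AB _ (here refl)                 _                = inj₁ refl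
  cutsOut-AB _ (there (here refl))         _                = inj₂ refl
  cutsOut-AB _ (there (there (here refl))) (_ , c≤lo , _)   = ⊥-elim (<⇒≱ (q-1<q c) c≤lo)

  cutsOut-AC : CutsOut P RAC A C
  cutsOut-AC _ (here refl)                 _                = inj₁ refl
  cutsOut-AC _ (there (here refl))         (_ , _ , hi≤c)   = ⊥-elim (<⇒≱ (q<q+1 c) hi≤c)
  cutsOut-AC _ (there (there (here refl))) _                = inj₂ refl

  cutsOut-BC : CutsOut P RBC B C
  cutsOut-BC _ (here refl)                 ((1≤0 , _) , _)  = ⊥-elim (<⇒≱ 0<1 1≤0)
  cutsOut-BC _ (there (here refl))         _                = inj₁ refl
  cutsOut-BC _ (there (there (here refl))) _                = inj₂ refl

  monoRect-of-equal-pair : (col : Coloring) (i j : Fin 3) → i <ᶠ j →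
                           col (vertex i) ≡ col (vertex j) →
                           ∃[ R ] (MeetsLine c R × MonoRect P col R)
  monoRect-of-equal-pair col zero (suc zero) _ eq =
    RAB , (≤-refl , <⇒≤ (q<q+1 c)) , monoRect-pair {R = RAB} A∈P B∈P A≢B A∈RAB B∈RAB cutsOut-AB eq
  monoRect-of-equal-pair col zero (suc (suc zero)) _ eq =
    RAC , (<⇒≤ (q-1<q c) , ≤-refl) , monoRect-pair {R = RAC} A∈P C∈P A≢C A∈RAC C∈RAC cutsOut-AC eq
  monoRect-of-equal-pair col (suc zero) (suc (suc zero)) _ eq =
    RBC , (<⇒≤ (q-1<q c) , <⇒≤ (q<q+1 c)) , monoRect-pair {R = RBC} B∈P C∈P B≢C B∈RBC C∈RBC cutsOut-BC eq
  monoRect-of-equal-pair col zero zero ()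
  monoRect-of-equal-pair col (suc zero) zero ()
  monoRect-of-equal-pair col (suc zero) (suc zero) (s≤s ())
  monoRect-of-equal-pair col (suc (suc zero)) zero ()
  monoRect-of-equal-pair col (suc (suc zero)) (suc zero) (s≤s ())
  monoRect-of-equal-pair col (suc (suc zero)) (suc (suc zero)) (s≤s (s≤s ()))

mainTheorem14 : (c : ℚ) → ChiTwoAtLeastThree c
mainTheorem14 c = P , P-unique , λ col →
  let i , j , i<j , same = pigeonhole (n<1+n 2) (col ∘ vertex)
  in monoRect-of-equal-pair col i j i<j same
  where open Triangle c
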